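{- Let $\mathcal{M}=\langle S,\to,L\rangle$ be a labeled transition system and $B\subseteq S\times S$. If $B$ is a reduced well-founded skipping relation (RWFSK) on $\mathcal{M}$, then $B$ is a skipping simulation (SKS) on $\mathcal{M}$.
   Context: A labeled transition system $\mathcal{M}=\langle S,\to,L\rangle$ consists of a non-empty (possibly infinite) set $S$, a left-total relation $\to\ \subseteq S\times S$, and a labeling function $L$ with domain $S$. A fullpath is an infinite sequence $\sigma(0),\sigma(1),\dots$ of states with $\sigma(i)\to\sigma(i+1)$ for all $i$; "$\sigma$ is a fullpath starting at $s$" means additionally $\sigma(0)=s$. $w\to^{+}v$ means $v$ is reachable from $w$ in finitely many, at least one, $\to$-steps. Matching: let INC be the set of strictly increasing sequences $\pi:\omega\to\omega$ with $\pi(0)=0$. For a fullpath $\sigma$ and $\pi\in$ INC, the $i$-th segment of $\sigma$ w.r.t. $\pi$ is the finite sequence $\sigma(\pi(i)),\dots,\sigma(\pi(i+1)-1)$. For $\pi,\xi\in$ INC, $\mathit{corr}(B,\sigma,\pi,\delta,\xi)$ holds iff for every $i\in\omega$ and every state $s$ in the $i$-th segment of $\sigma$ w.r.t. $\pi$, $s\,B\,\delta(\xi(i))$. $\mathit{match}(B,\sigma,\delta)$ holds iff there exist $\pi,\xi\in$ INC with $\mathit{corr}(B,\sigma,\pi,\delta,\xi)$. $B$ is an SKS on $\mathcal{M}$ iff for all $s,w$ with $sBw$: (SKS1) $L(s)=L(w)$; and (SKS2) for every fullpath $\sigma$ starting at $s$ there exists a fullpath $\delta$ starting at $w$ with $\mathit{match}(B,\sigma,\delta)$.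 $B$ is an RWFSK on $\mathcal{M}$ iff: (RWFSK1) for all $s,w$ with $sBw$, $L(s)=L(w)$; and (RWFSK2) there exist a well-founded structure $\langle W,\prec\rangle$ and $\mathit{rankt}:S\times S\to W$ such that for all $s,u,w\in S$ with $s\to u$ and $sBw$: either (a) $uBw$ and $\mathit{rankt}(u,w)\prec\mathit{rankt}(s,w)$, or (b) there is $v$ with $w\to^{+}v$ and $uBv$. -}

module Defs where

open import Data.Nat using (ℕ; suc; _<_; _≤_)
open import Data.Product using (Σ; ∃; _×_; _,_)
open import Data.Sum using (_⊎_)
open import Relation.Binary.PropositionalEquality using (_≡_)
open import Induction.WellFounded using (WellFounded)

record LTS (Lbl : Set) : Set₁ where
  field
    S     : Set
    _⟶_   : S → S → Set
    total : ∀ s → ∃ λ u → s ⟶ u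
    L     : S → Lbl

module _ {Lbl : Set} (M : LTS Lbl) where
  open LTS M

  IsFullpath : (ℕ → S) → Set
  IsFullpath σ = ∀ i → σ i ⟶ σ (suc i)

  FullpathFrom : S → (ℕ → S) → Set
  FullpathFrom s σ = IsFullpath σ × σ 0 ≡ s

  data _⟶⁺_ : S → S → Set where
    step : ∀ {w v} → w ⟶ v → w ⟶⁺ v
    _∷_  : ∀ {w u v} → w ⟶ u → u ⟶⁺ v → w ⟶⁺ v

  INC : (ℕ → ℕ) → Set
  INC π = π 0 ≡ 0 × (∀ i → π i < π (suc i))

  corr : (S → S → Set) → (ℕ → S) → (ℕ → ℕ) → (ℕ → S) → (ℕ → ℕ) → Set
  corr B σ π δ ξ =
    ∀ i k → π i ≤ k → k < π (suc i) → B (σ k) (δ (ξ i))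

  match : (S → S → Set) → (ℕ → S) → (ℕ → S) → Set
  match B σ δ = Σ (ℕ → ℕ) λ π → Σ (ℕ → ℕ) λ ξ →
    INC π × INC ξ × corr B σ π δ ξ

  SKS : (S → S → Set) → Set
  SKS B = ∀ s w → B s w →
    (L s ≡ L w) ×
    (∀ σ → FullpathFrom s σ → Σ (ℕ → S) λ δ → FullpathFrom w δ × match B σ δ)

  RWFSK : (S → S → Set) → Set₁
  RWFSK B =
    (∀ s w → B s w → L s ≡ L w) ×
    Σ Set λ W → Σ (W → W → Set) λ _≺_ → WellFounded _≺_ ×
      Σ (S → S → W) λ rankt →
        ∀ s u w → s ⟶ u → B s w →
          (B u w × rankt u w ≺ rankt s w) ⊎ (∃ λ v → (w ⟶⁺ v) × B u v)

-- Fix a fullpath σ from s with s B w. From any pair σ k B w, the RWFSK condition lets σ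
-- advance while w stays put, which can happen only finitely often because the rank
-- decreases each time; so some σ k' is eventually matched by a state v with w →⁺ v, and
-- every σ j with k ≤ j < k' is related to w. Iterating yields anchors σ kₙ B wₙ with
-- wₙ →⁺ wₙ₊₁; concatenating these paths gives δ, and the kₙ together with the positions
-- of the wₙ on δ are the two sequences of the matching.
module Submission where

open import Defs
open import Data.Nat using (ℕ; zero; suc; _+_; _<_; _≤_; s≤s; z≤n)
open import Data.Nat.Properties using (n<1+n; <-trans; m<m+n; m≤n⇒m<n∨m≡n; m<1+n⇒m≤n; ≤-antisym)
open import Data.Product using (Σ; ∃; _×_; _,_)
open import Data.Sum using (_⊎_; inj₁; inj₂)
open import Relation.Binary.PropositionalEquality using (_≡_; refl; sym; trans; cong; subst)
open import Induction.WellFounded using (WellFounded; Acc; acc)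

module _ {Lbl : Set} (M : LTS Lbl) where
  open LTS M

  length⁺ : ∀ {w v} → _⟶⁺_ M w v → ℕ
  length⁺ (step _) = 1
  length⁺ (_ ∷ p)  = suc (length⁺ p)

  0<length⁺ : ∀ {w v} (p : _⟶⁺_ M w v) → 0 < length⁺ p
  0<length⁺ (step _) = s≤s z≤n
  0<length⁺ (_ ∷ _)  = s≤s z≤n

  module Concatenation (v : ℕ → S) (path : ∀ n → _⟶⁺_ M (v n) (v (suc n))) where

    record Position : Set where
      constructor at
      field
        segment : ℕ
        state   : S
        rest    : _⟶⁺_ M state (v (suc segment))
    open Position

    start : ℕ → Position
    start n = at n (v n) (path n)

    advance : Position → Position
    advance (at n _ (step _))             = start (suc n)
    advance (at n _ (_∷_ {u = u} _ rest)) = at n u rest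

    state⟶advance : ∀ x → state x ⟶ state (advance x)
    state⟶advance (at _ _ (step t)) = t
    state⟶advance (at _ _ (t ∷ _))  = t

    advanceBy : ℕ → Position → Position
    advanceBy zero    x = x
    advanceBy (suc m) x = advanceBy m (advance x)

    advanceBy-suc : ∀ m x → advanceBy (suc m) x ≡ advance (advanceBy m x)
    advanceBy-suc zero    x = refl
    advanceBy-suc (suc m) x = advanceBy-suc m (advance x)

    advanceBy-+ : ∀ m n x → advanceBy (m + n) x ≡ advanceBy n (advanceBy m x)
    advanceBy-+ zero    n x = refl
    advanceBy-+ (suc m) n x = advanceBy-+ m n (advance x)

    advanceBy-length⁺ : ∀ n c (p : _⟶⁺_ M c (v (suc n))) →
      advanceBy (length⁺ p) (at n c p) ≡ start (suc n)
    advanceBy-length⁺ n c (step _)             = refl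
    advanceBy-length⁺ n c (_∷_ {u = u} _ rest) = advanceBy-length⁺ n u rest

    δ : ℕ → S
    δ m = state (advanceBy m (start 0))

    δ-fullpath : IsFullpath M δ
    δ-fullpath m =
      subst (λ x → δ m ⟶ state x) (sym (advanceBy-suc m (start 0)))
            (state⟶advance (advanceBy m (start 0)))

    ξ : ℕ → ℕ
    ξ zero    = 0
    ξ (suc n) = ξ n + length⁺ (path n)

    ξ-inc : INC M ξ
    ξ-inc = refl , λ n → m<m+n (ξ n) (0<length⁺ (path n))

    advanceBy-ξ : ∀ n → advanceBy (ξ n) (start 0) ≡ start n
    advanceBy-ξ zero    = refl
    advanceBy-ξ (suc n) = trans (advanceBy-+ (ξ n) _ (start 0))
      (trans (cong (advanceBy (length⁺ (path n))) (advanceBy-ξ n))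
             (advanceBy-length⁺ n (v n) (path n)))

    δ∘ξ : ∀ n → δ (ξ n) ≡ v n
    δ∘ξ n = cong state (advanceBy-ξ n)

  concatenate : (v : ℕ → S) → (∀ n → _⟶⁺_ M (v n) (v (suc n))) →
    Σ (ℕ → S) λ δ → FullpathFrom M (v 0) δ ×
      Σ (ℕ → ℕ) λ ξ → INC M ξ × (∀ n → δ (ξ n) ≡ v n)
  concatenate v path = δ , (δ-fullpath , refl) , ξ , ξ-inc , δ∘ξ
    where open Concatenation v path

module Skipping {Lbl : Set} (M : LTS Lbl) (B : LTS.S M → LTS.S M → Set)
  {W : Set} {_≺_ : W → W → Set} (≺-wf : WellFounded _≺_) (rankt : LTS.S M → LTS.S M → W)
  (reduced : ∀ s u w → LTS._⟶_ M s u → B s w →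
               (B u w × rankt u w ≺ rankt s w) ⊎ (∃ λ v → (_⟶⁺_ M w v) × B u v))
  {σ : ℕ → LTS.S M} (σ-fullpath : IsFullpath M σ) where
  open LTS M

  record Anchor : Set where
    constructor anchor
    field
      index   : ℕ
      target  : S
      related : B (σ index) target
  open Anchor

  record Skip (a : Anchor) : Set where
    field
      next     : Anchor
      advances : index a < index next
      reaches  : _⟶⁺_ M (target a) (target next)
      covers   : ∀ j → index a ≤ j → j < index next → B (σ j) (target a)
  open Skip

  skip-acc : ∀ k w (r : B (σ k) w) → Acc _≺_ (rankt (σ k) w) → Skip (anchor k w r)
  skip-acc k w r (acc rs) with reduced (σ k) (σ (suc k)) w (σ-fullpath k) r
  ... | inj₂ (v , w⟶⁺v , r′) = record
    { next = anchor (suc k) v r′ ; advances = n<1+n k ; reaches = w⟶⁺v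
    ; covers = λ j k≤j j<1+k →
        subst (λ i → B (σ i) w) (≤-antisym k≤j (m<1+n⇒m≤n j<1+k)) r }
  ... | inj₁ (r′ , smaller) = record
    { next = next later ; advances = <-trans (n<1+n k) (advances later)
    ; reaches = reaches later ; covers = covers′ }
    where
    later : Skip (anchor (suc k) w r′)
    later = skip-acc (suc k) w r′ (rs smaller)

    covers′ : ∀ j → k ≤ j → j < index (next later) → B (σ j) w
    covers′ j k≤j j<k′ with m≤n⇒m<n∨m≡n k≤j
    ... | inj₁ k<j  = covers later j k<j j<k′
    ... | inj₂ refl = r

  skip : (a : Anchor) → Skip a
  skip (anchor k w r) = skip-acc k w r (≺-wf _)

  anchors : Anchor → ℕ → Anchor
  anchors a zero    = a
  anchors a (suc n) = next (skip (anchors a n))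

  matching-fullpath : (a : Anchor) → index a ≡ 0 →
    Σ (ℕ → S) λ δ → FullpathFrom M (target a) δ × match M B σ δ
  matching-fullpath a index≡0 with concatenate M (λ n → target (anchors a n))
                                               (λ n → reaches (skip (anchors a n)))
  ... | δ , δ-from , ξ , ξ-inc , δ∘ξ = δ , δ-from , π , ξ , π-inc , ξ-inc , correspond
    where
    π : ℕ → ℕ
    π n = index (anchors a n)

    π-inc : INC M π
    π-inc = index≡0 , λ n → advances (skip (anchors a n))

    correspond : corr M B σ π δ ξ
    correspond i j π≤j j<π =
      subst (B (σ j)) (sym (δ∘ξ i)) (covers (skip (anchors a i)) j π≤j j<π)

theorem2 : {Lbl : Set} (M : LTS Lbl) (B : LTS.S M → LTS.S M → Set) →
    RWFSK M B → SKS M B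
theorem2 M B (same-label , _ , _ , ≺-wf , rankt , reduced) s w sBw =
  same-label s w sBw , λ σ (σ-fullpath , σ0≡s) →
    let open Skipping M B ≺-wf rankt reduced σ-fullpath
    in matching-fullpath (anchor 0 w (subst (λ x → B x w) (sym σ0≡s) sBw)) refl
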